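{- Let $\Gamma=R_n(a,r)$ be a non-trivially unstable Rose Window graph with $n=2m$, $1\le a,r\le m$, such that $\Gamma\times\mathbf{K}_2$ is edge-transitive. Let $G=\mathrm{Aut}(\Gamma\times\mathbf{K}_2)$ and $C=\langle\rho\rangle$, where $\rho(u_{i,j})=u_{i+1,j}$, $\rho(v_{i,j})=v_{i+1,j}$. If $C$ is normal in $G$, then $m$ is odd and $\Gamma$ is isomorphic to a graph in the family W4.
   Context: $R_n(a,r)$ ($n\ge3$, $a,r\in\mathbb{Z}_n$ nonzero) has vertices $u_i,v_i$ ($i\in\mathbb{Z}_n$) and edges $\{u_i,u_{i+1}\},\{v_i,v_{i+r}\},\{u_i,v_i\},\{u_{i+a},v_i\}$. The canonical double cover $\Gamma\times\mathbf{K}_2$ has vertices $u_{i,j}=(u_i,j)$, $v_{i,j}=(v_i,j)$, $j\in\mathbb{Z}_2$, and edges $\{(x,0),(y,1)\}$ for $\{x,y\}\in E(\Gamma)$. $\Gamma$ is stable if $\mathrm{Aut}(\Gamma\times\mathbf{K}_2)\cong\mathrm{Aut}(\Gamma)\times\mathbb{Z}_2$, unstable otherwise; non-trivially unstable means unstable, connected, non-bipartite, and no two distinct vertices have the same neighborhood. Family W4 consists of the graphs $R_{2k}(A,k-1)$ with $A\ne k$ ($k$ a positive integer). -}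

module Defs where

open import Data.Nat using (ℕ; zero; suc; _+_; _*_; _∸_; _%_; _<_; _≤_)
open import Data.Nat.DivMod using (m%n<n)
open import Data.Fin using (Fin; toℕ; fromℕ<)
open import Data.Bool using (Bool; true; false; _xor_)
open import Data.Product using (Σ; _×_; _,_; proj₁; proj₂)
open import Data.Sum using (_⊎_)
open import Relation.Binary.PropositionalEquality using (_≡_; _≢_)
open import Relation.Nullary using (¬_)

record Graph : Set₁ where
  field
    V : Set
    E : V → V → Set
open Graph public

_⊕_ : ∀ {n} → Fin n → ℕ → Fin n
_⊕_ {suc n} i k = fromℕ< (m%n<n (toℕ i + k) (suc n))

data RV (n : ℕ) : Set where
  u : Fin n → RV n
  v : Fin n → RV n

data REdge (n a r : ℕ) : RV n → RV n → Set where
  rim   : ∀ i → REdge n a r (u i) (u (i ⊕ 1))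
  hub   : ∀ i → REdge n a r (v i) (v (i ⊕ r))
  spoke : ∀ i → REdge n a r (u i) (v i)
  spk2  : ∀ i → REdge n a r (u (i ⊕ a)) (v i)

Rose : (n a r : ℕ) → Graph
Rose n a r = record
  { V = RV n
  ; E = λ x y → REdge n a r x y ⊎ REdge n a r y x }

DC : Graph → Graph
DC Γ = record
  { V = V Γ × Bool
  ; E = λ p q → E Γ (proj₁ p) (proj₁ q) × (proj₂ p ≢ proj₂ q) }

record Iso (G H : Graph) : Set where
  field
    fun    : V G → V H
    inv    : V H → V G
    inv-l  : ∀ x → inv (fun x) ≡ x
    inv-r  : ∀ y → fun (inv y) ≡ y
    pres   : ∀ x y → E G x y → E H (fun x) (fun y)
    refl'  : ∀ x y → E H (fun x) (fun y) → E G x y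
open Iso public

Aut : Graph → Set
Aut G = Iso G G

_≈A_ : ∀ {G} → Aut G → Aut G → Set
_≈A_ {G} f g = ∀ (x : V G) → fun f x ≡ fun g x

_∘A_ : ∀ {G} → Aut G → Aut G → Aut G
f ∘A g = record
  { fun   = λ x → fun f (fun g x)
  ; inv   = λ y → inv g (inv f y)
  ; inv-l = λ x → lemma-l x
  ; inv-r = λ y → lemma-r y
  ; pres  = λ x y e → pres f _ _ (pres g x y e)
  ; refl' = λ x y e → refl' g x y (refl' f _ _ e) }
  where
  open import Relation.Binary.PropositionalEquality using (cong; trans)
  lemma-l : ∀ x → inv g (inv f (fun f (fun g x))) ≡ x
  lemma-l x = trans (cong (inv g) (inv-l f (fun g x))) (inv-l g x)
  lemma-r : ∀ y → fun f (fun g (inv g (inv f y))) ≡ y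
  lemma-r y = trans (cong (fun f) (inv-r g (inv f y))) (inv-r f y)

_≈P_ : ∀ {G} → Aut G × Bool → Aut G × Bool → Set
(f , b) ≈P (g , c) = (f ≈A g) × (b ≡ c)

_∙P_ : ∀ {G} → Aut G × Bool → Aut G × Bool → Aut G × Bool
(f , b) ∙P (g , c) = (f ∘A g , b xor c)

-- Aut(Γ × K₂) ≅ Aut(Γ) × Z₂ as abstract groups: a bijective homomorphism
-- (well defined and injective w.r.t. the group equalities).
Stable : Graph → Set
Stable Γ =
  Σ (Aut (DC Γ) → Aut Γ × Bool) λ φ →
      (∀ f g → f ≈A g → φ f ≈P φ g)
    × (∀ f g → φ f ≈P φ g → f ≈A g)
    × (∀ y → Σ (Aut (DC Γ)) λ f → φ f ≈P y)
    × (∀ f g → φ (f ∘A g) ≈P (φ f ∙P φ g))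

Unstable : Graph → Set
Unstable Γ = ¬ Stable Γ

data Walk (G : Graph) : V G → V G → Set where
  here : ∀ {x} → Walk G x x
  step : ∀ {x y z} → E G x y → Walk G y z → Walk G x z

Connected : Graph → Set
Connected G = ∀ x y → Walk G x y

Bipartite : Graph → Set
Bipartite G = Σ (V G → Bool) λ c → ∀ x y → E G x y → c x ≢ c y

TwinFree : Graph → Set
TwinFree G = ∀ x y → (∀ z → (E G x z → E G y z) × (E G y z → E G x z)) → x ≡ y

NontriviallyUnstable : Graph → Set
NontriviallyUnstable Γ =
  Unstable Γ × Connected Γ × ¬ Bipartite Γ × TwinFree Γ

EdgeTransitive : Graph → Set
EdgeTransitive G =
  ∀ x y x' y' → E G x y → E G x' y' →
  Σ (Aut G) λ g → ((fun g x ≡ x') × (fun g y ≡ y'))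
                ⊎ ((fun g x ≡ y') × (fun g y ≡ x'))

rotV : ∀ {n} → RV n → RV n
rotV (u i) = u (i ⊕ 1)
rotV (v i) = v (i ⊕ 1)

ρ : ∀ {n} → RV n × Bool → RV n × Bool
ρ (x , j) = (rotV x , j)

ρ^ : ∀ {n} → ℕ → RV n × Bool → RV n × Bool
ρ^ zero    p = p
ρ^ (suc k) p = ρ (ρ^ k p)

InC : ∀ {n a r} → Aut (DC (Rose n a r)) → Set
InC h = Σ ℕ λ k → ∀ p → fun h p ≡ ρ^ k p

CNormal : (n a r : ℕ) → Set
CNormal n a r = ∀ (g : Aut (DC (Rose n a r))) (k : ℕ) →
  Σ ℕ λ l → ∀ p → fun g (ρ^ k (inv g p)) ≡ ρ^ l p

-- Family W4: R_{2k}(A, k-1) with A ≠ k (A ∈ Z_{2k} nonzero, k ≥ 2 so that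
-- R_{2k}(A,k-1) is a Rose Window graph).

InW4 : Graph → Set
InW4 Γ = Σ ℕ λ k → Σ ℕ λ A →
  (2 ≤ k) × (A < 2 * k) × (A ≢ 0) × (A ≢ k) × Iso Γ (Rose (2 * k) A (k ∸ 1))

-- Let g be an automorphism of Γ × K₂. Normality of C = ⟨ρ⟩ gives g ρ g⁻¹ = ρˡ, hence g ρᵏ = ρᵏˡ g,
-- and kl ≢ 0 (mod n) whenever k ≢ 0. The vertex (u_a, 0) has the rim neighbours (u_{a-1}, 1) and
-- ρ²(u_{a-1}, 1), and the spoke neighbours (v_0, 1) and ρᵃ(v_0, 1). By edge-transitivity some g₁ maps
-- the first rim edge onto a hub edge; then the two rim neighbours go to the two hub neighbours v_{j±r}
-- of some v_j, so 2l₁ ≡ ±2r, and as v_j has no third hub neighbour the two spoke neighbours go to u_j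
-- and u_{j+a}, so al₁ ≡ ±a (mod n = 2m). Likewise some g₂ maps the spoke edge onto a rim edge, giving
-- al₂ ≡ ±2, where l₂ is odd because ρᵐ ≠ 1. Eliminating l₁ and l₂ yields r ≡ ±1 (mod m), and al₂ ≡ ±2
-- with l₂ odd makes a even. If r were odd, colouring u_i by the parity of i and v_i by the opposite
-- parity would make Γ bipartite; so r is even, which leaves r = m − 1 with m odd, and a ≠ m as a is even.

module Submission where

open import Data.Bool using (Bool; true; false; not; _∧_; _xor_; if_then_else_)
open import Data.Bool.Properties
  using (not-distribˡ-xor; xor-identityʳ; ∧-zeroʳ; ∧-identityʳ; not-¬; ¬-not; not-injective; xor-comm)
open import Data.Empty using (⊥; ⊥-elim)
open import Data.Fin using (Fin; toℕ) renaming (zero to fzero)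
import Data.Fin.Properties as Fin
open import Data.Integer using (ℤ; +_; _+_; _*_; _-_; -_; _⊖_; 0ℤ; 1ℤ; -1ℤ; ∣_∣)
open import Data.Integer.Divisibility.Signed
  using (_∣_; divides; ∣-trans; ∣m∣n⇒∣m+n; ∣m⇒∣-m; ∣n⇒∣m*n; ∣⇒∣ᵤ; ∣ᵤ⇒∣)
import Data.Integer.Properties as ℤ
open import Data.Integer.Tactic.RingSolver using (solve-∀; solve)
open import Data.List using ([]; _∷_)
open import Data.Nat as ℕ using (ℕ; zero; suc; s≤s; z≤n; _%_; _/_)
open import Data.Nat.DivMod using (m%n<n; m≡m%n+[m/n]*n)
import Data.Nat.Divisibility as ℕ
import Data.Nat.Properties as ℕ
import Data.Nat.Tactic.RingSolver as ℕ-Solver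
open import Data.Product using (Σ; _×_; _,_; _,′_; proj₁)
open import Data.Sum using (_⊎_; inj₁; inj₂; [_,_]′)
open import Function using (_∘_)
open import Level using (0ℓ)
open import Relation.Binary using (Setoid)
open import Relation.Binary.PropositionalEquality
import Relation.Binary.Reasoning.Setoid as SetoidReasoning
open import Relation.Nullary using (¬_; contradiction)

open import Defs

infix 4 _≡_[mod_]

record _≡_[mod_] (x y : ℤ) (n : ℕ) : Set where
  constructor ≡mod
  field divides-difference : + n ∣ x - y

∣-resp-≡ : ∀ {d x y} → d ∣ x → x ≡ y → d ∣ y
∣-resp-≡ d∣x refl = d∣x

module _ {n : ℕ} where

  ≡mod-refl : ∀ {x} → x ≡ x [mod n ]
  ≡mod-refl {x} = ≡mod (divides 0ℤ (ℤ.+-inverseʳ x))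

  ≡mod-sym : ∀ {x y} → x ≡ y [mod n ] → y ≡ x [mod n ]
  ≡mod-sym {x} {y} (≡mod p) = ≡mod (∣-resp-≡ (∣m⇒∣-m p) (solve (x ∷ y ∷ [])))

  ≡mod-trans : ∀ {x y z} → x ≡ y [mod n ] → y ≡ z [mod n ] → x ≡ z [mod n ]
  ≡mod-trans {x} {y} {z} (≡mod p) (≡mod q) =
    ≡mod (∣-resp-≡ (∣m∣n⇒∣m+n p q) (solve (x ∷ y ∷ z ∷ [])))

  ≡⇒≡mod : ∀ {x y} → x ≡ y → x ≡ y [mod n ]
  ≡⇒≡mod {x} refl = ≡mod-refl {x}

  +-cong-≡mod : ∀ {x y x' y'} → x ≡ y [mod n ] → x' ≡ y' [mod n ] → x + x' ≡ y + y' [mod n ]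
  +-cong-≡mod {x} {y} {x'} {y'} (≡mod p) (≡mod q) =
    ≡mod (∣-resp-≡ (∣m∣n⇒∣m+n p q) (solve (x ∷ y ∷ x' ∷ y' ∷ [])))

  -‿cong-≡mod : ∀ {x y} → x ≡ y [mod n ] → - x ≡ - y [mod n ]
  -‿cong-≡mod {x} {y} (≡mod p) = ≡mod (∣-resp-≡ (∣m⇒∣-m p) (solve (x ∷ y ∷ [])))

  *-congˡ-≡mod : ∀ z {x y} → x ≡ y [mod n ] → z * x ≡ z * y [mod n ]
  *-congˡ-≡mod z {x} {y} (≡mod p) = ≡mod (∣-resp-≡ (∣n⇒∣m*n z p) (solve (z ∷ x ∷ y ∷ [])))

  *-congʳ-≡mod : ∀ z {x y} → x ≡ y [mod n ] → x * z ≡ y * z [mod n ]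
  *-congʳ-≡mod z {x} {y} (≡mod p) = ≡mod (∣-resp-≡ (∣n⇒∣m*n z p) (solve (z ∷ x ∷ y ∷ [])))

≡mod-setoid : ℕ → Setoid 0ℓ 0ℓ
≡mod-setoid n = record
  { Carrier       = ℤ
  ; _≈_           = λ x y → x ≡ y [mod n ]
  ; isEquivalence = record { refl = ≡mod-refl ; sym = ≡mod-sym ; trans = ≡mod-trans } }

module ≡mod-Reasoning (n : ℕ) = SetoidReasoning (≡mod-setoid n)

≡mod-∣ : ∀ {d n x y} → d ℕ.∣ n → x ≡ y [mod n ] → x ≡ y [mod d ]
≡mod-∣ d∣n (≡mod p) = ≡mod (∣-trans (∣ᵤ⇒∣ d∣n) p)

*-cancelˡ-≡mod : ∀ k {n x y} .{{_ : ℕ.NonZero k}} →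
                 + k * x ≡ + k * y [mod k ℕ.* n ] → x ≡ y [mod n ]
*-cancelˡ-≡mod k {n} {x} {y} (≡mod (divides q eq)) =
  ≡mod (divides q (ℤ.*-cancelˡ-≡ (+ k) (x - y) (q * + n)
    (factor (+ k) (+ n) (trans eq (cong (q *_) (ℤ.pos-* k n))))))
  where
  factor : ∀ K N → K * x - K * y ≡ q * (K * N) → K * (x - y) ≡ K * (q * N)
  factor K N e = begin
    K * (x - y)      ≡⟨ solve (K ∷ x ∷ y ∷ []) ⟩
    K * x - K * y    ≡⟨ e ⟩
    q * (K * N)      ≡⟨ solve (q ∷ K ∷ N ∷ []) ⟩
    K * (q * N)      ∎
    where open ≡-Reasoning

multiple≡0 : ∀ q n → + (q ℕ.* n) ≡ 0ℤ [mod n ]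
multiple≡0 q n = ≡mod (divides (+ q) (trans (ℤ.+-identityʳ (+ (q ℕ.* n))) (ℤ.pos-* q n)))

≡mod-% : ∀ x n .{{_ : ℕ.NonZero n}} → + (x % n) ≡ + x [mod n ]
≡mod-% x n = ≡mod-sym (begin
  + x                            ≡⟨ cong +_ (m≡m%n+[m/n]*n x n) ⟩
  + (x % n ℕ.+ x / n ℕ.* n)      ≡⟨ ℤ.pos-+ (x % n) (x / n ℕ.* n) ⟩
  + (x % n) + + (x / n ℕ.* n)    ≈⟨ +-cong-≡mod (≡mod-refl {x = + (x % n)}) (multiple≡0 (x / n) n) ⟩
  + (x % n) + 0ℤ                 ≡⟨ ℤ.+-identityʳ (+ (x % n)) ⟩
  + (x % n)                      ∎)
  where open ≡mod-Reasoning n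

modulus≡0 : ∀ n → + n ≡ 0ℤ [mod n ]
modulus≡0 n = subst (λ t → + t ≡ 0ℤ [mod n ]) (ℕ.*-identityˡ n) (multiple≡0 1 n)

<∧∣⇒≡0 : ∀ {k n} → k ℕ.< n → n ℕ.∣ k → k ≡ 0
<∧∣⇒≡0 {zero}  k<n n∣k = refl
<∧∣⇒≡0 {suc k} k<n n∣k = contradiction n∣k (ℕ.>⇒∤ k<n)

≤⇒∣[+x]-[+y]∣<n : ∀ {x y n} → x ℕ.≤ y → y ℕ.< n → ∣ + x - + y ∣ ℕ.< n
≤⇒∣[+x]-[+y]∣<n {x} {y} {n} x≤y y<n = begin-strict
  ∣ + x - + y ∣  ≡⟨ cong ∣_∣ (ℤ.[+m]-[+n]≡m⊖n x y) ⟩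
  ∣ x ⊖ y ∣      ≡⟨ ℤ.∣⊖∣-≤ x≤y ⟩
  y ℕ.∸ x        ≤⟨ ℕ.m∸n≤m y x ⟩
  y              <⟨ y<n ⟩
  n              ∎
  where open ℕ.≤-Reasoning

∣[+x]-[+y]∣<n : ∀ {x y n} → x ℕ.< n → y ℕ.< n → ∣ + x - + y ∣ ℕ.< n
∣[+x]-[+y]∣<n {x} {y} {n} x<n y<n with ℕ.≤-total x y
... | inj₁ x≤y = ≤⇒∣[+x]-[+y]∣<n x≤y y<n
... | inj₂ y≤x = subst (ℕ._< n) (ℤ.∣i-j∣≡∣j-i∣ (+ y) (+ x)) (≤⇒∣[+x]-[+y]∣<n y≤x x<n)

≡mod⇒≡ : ∀ {n x y} → x ℕ.< n → y ℕ.< n → + x ≡ + y [mod n ] → x ≡ y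
≡mod⇒≡ {n} {x} {y} x<n y<n (≡mod p) =
  ℤ.+-injective (ℤ.i-j≡0⇒i≡j (+ x) (+ y)
    (ℤ.∣i∣≡0⇒i≡0 (<∧∣⇒≡0 (∣[+x]-[+y]∣<n x<n y<n) (∣⇒∣ᵤ p))))

≢0-below : ∀ {k n} → 0 ℕ.< k → k ℕ.< n → ¬ + k ≡ 0ℤ [mod n ]
≢0-below 0<k k<n k≡0 = ℕ.<⇒≢ 0<k (sym (≡mod⇒≡ k<n (ℕ.<-trans 0<k k<n) k≡0))

data IsUnit : ℤ → Set where
  one       : IsUnit 1ℤ
  minus-one : IsUnit -1ℤ

IsUnit-* : ∀ {ε δ} → IsUnit ε → IsUnit δ → IsUnit (ε * δ)
IsUnit-* one       one       = one
IsUnit-* one       minus-one = minus-one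
IsUnit-* minus-one one       = minus-one
IsUnit-* minus-one minus-one = one

IsUnit-square : ∀ {ε} → IsUnit ε → ε * ε ≡ 1ℤ
IsUnit-square one       = refl
IsUnit-square minus-one = refl

infix 4 _≡±_[mod_] _≡_∨_[mod_]

_≡±_[mod_] : ℤ → ℤ → ℕ → Set
x ≡± y [mod n ] = Σ ℤ λ ε → IsUnit ε × x ≡ ε * y [mod n ]

_≡_∨_[mod_] : ℤ → ℤ → ℤ → ℕ → Set
x ≡ y ∨ z [mod n ] = x ≡ y [mod n ] ⊎ x ≡ z [mod n ]

module _ {n : ℕ} where
  open ≡mod-Reasoning n

  unit-swap : ∀ {ε x y} → IsUnit ε → x ≡ ε * y [mod n ] → y ≡ ε * x [mod n ]
  unit-swap {ε} {x} {y} unit x≡εy = begin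
    y              ≡⟨ solve (y ∷ []) ⟩
    1ℤ * y         ≡⟨ cong (_* y) (IsUnit-square unit) ⟨
    ε * ε * y      ≡⟨ solve (ε ∷ y ∷ []) ⟩
    ε * (ε * y)    ≈⟨ *-congˡ-≡mod ε x≡εy ⟨
    ε * x          ∎

  ∨-resp-≡mod : ∀ {x x' y z} → x ≡ x' [mod n ] → x ≡ y ∨ z [mod n ] → x' ≡ y ∨ z [mod n ]
  ∨-resp-≡mod x≡x' (inj₁ x≡y) = inj₁ (≡mod-trans (≡mod-sym x≡x') x≡y)
  ∨-resp-≡mod x≡x' (inj₂ x≡z) = inj₂ (≡mod-trans (≡mod-sym x≡x') x≡z)

  ≡mod-difference : ∀ {x s y z} → x ≡ y [mod n ] → x + s ≡ z [mod n ] → s ≡ z - y [mod n ]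
  ≡mod-difference {x} {s} {y} {z} x≡y x+s≡z = begin
    s              ≡⟨ solve (x ∷ s ∷ []) ⟩
    (x + s) - x    ≈⟨ +-cong-≡mod x+s≡z (-‿cong-≡mod x≡y) ⟩
    z - y          ∎

  ≡±-resp : ∀ {x x' y y'} → x ≡ x' → y ≡ y' → x ≡± y [mod n ] → x' ≡± y' [mod n ]
  ≡±-resp refl refl x≡±y = x≡±y

  shift-between-residues : ∀ {x s c α β} →
    x ≡ c + α ∨ c + β [mod n ] → x + s ≡ c + α ∨ c + β [mod n ] →
    ¬ s ≡ 0ℤ [mod n ] → s ≡± β - α [mod n ]
  shift-between-residues {x} {s} {c} {α} {β} (inj₁ p) (inj₁ q) s≢0 =
    contradiction (≡mod-trans (≡mod-difference p q) (≡⇒≡mod (solve (c ∷ α ∷ [])))) s≢0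
  shift-between-residues {x} {s} {c} {α} {β} (inj₁ p) (inj₂ q) _ =
    1ℤ , one , ≡mod-trans (≡mod-difference p q) (≡⇒≡mod (solve (c ∷ α ∷ β ∷ [])))
  shift-between-residues {x} {s} {c} {α} {β} (inj₂ p) (inj₁ q) _ =
    -1ℤ , minus-one , ≡mod-trans (≡mod-difference p q) (≡⇒≡mod (solve (c ∷ α ∷ β ∷ [])))
  shift-between-residues {x} {s} {c} {α} {β} (inj₂ p) (inj₂ q) s≢0 =
    contradiction (≡mod-trans (≡mod-difference p q) (≡⇒≡mod (solve (c ∷ β ∷ [])))) s≢0

  pigeonhole-residues : ∀ {x y z c d} →
    x ≡ c ∨ d [mod n ] → y ≡ c ∨ d [mod n ] → z ≡ c ∨ d [mod n ] →
    x ≡ y [mod n ] ⊎ x ≡ z [mod n ] ⊎ y ≡ z [mod n ]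
  pigeonhole-residues (inj₁ x≡c) (inj₁ y≡c) _          = inj₁ (≡mod-trans x≡c (≡mod-sym y≡c))
  pigeonhole-residues (inj₂ x≡d) (inj₂ y≡d) _          = inj₁ (≡mod-trans x≡d (≡mod-sym y≡d))
  pigeonhole-residues (inj₁ x≡c) (inj₂ _)   (inj₁ z≡c) = inj₂ (inj₁ (≡mod-trans x≡c (≡mod-sym z≡c)))
  pigeonhole-residues (inj₂ x≡d) (inj₁ _)   (inj₂ z≡d) = inj₂ (inj₁ (≡mod-trans x≡d (≡mod-sym z≡d)))
  pigeonhole-residues (inj₁ _)   (inj₂ y≡d) (inj₂ z≡d) = inj₂ (inj₂ (≡mod-trans y≡d (≡mod-sym z≡d)))
  pigeonhole-residues (inj₂ _)   (inj₁ y≡c) (inj₁ z≡c) = inj₂ (inj₂ (≡mod-trans y≡c (≡mod-sym z≡c)))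

parity : ℕ → Bool
parity zero    = false
parity (suc k) = not (parity k)

parity-+ : ∀ x y → parity (x ℕ.+ y) ≡ parity x xor parity y
parity-+ zero    y = refl
parity-+ (suc x) y = trans (cong not (parity-+ x y)) (not-distribˡ-xor (parity x) (parity y))

parity-* : ∀ x y → parity (x ℕ.* y) ≡ parity x ∧ parity y
parity-* zero    y = refl
parity-* (suc x) y = begin
  parity (y ℕ.+ x ℕ.* y)             ≡⟨ parity-+ y (x ℕ.* y) ⟩
  parity y xor parity (x ℕ.* y)      ≡⟨ cong (parity y xor_) (parity-* x y) ⟩
  parity y xor (parity x ∧ parity y) ≡⟨ absorb (parity x) (parity y) ⟩
  not (parity x) ∧ parity y          ∎
  where
  open ≡-Reasoning
  absorb : ∀ b c → c xor (b ∧ c) ≡ not b ∧ c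
  absorb false c     = xor-identityʳ c
  absorb true  false = refl
  absorb true  true  = refl

parity-% : ∀ x n .{{_ : ℕ.NonZero n}} → parity n ≡ false → parity (x % n) ≡ parity x
parity-% x n even-n = sym (begin
  parity x                                 ≡⟨ cong parity (m≡m%n+[m/n]*n x n) ⟩
  parity (x % n ℕ.+ x / n ℕ.* n)           ≡⟨ parity-+ (x % n) (x / n ℕ.* n) ⟩
  parity (x % n) xor parity (x / n ℕ.* n)  ≡⟨ cong (parity (x % n) xor_) multiple-even ⟩
  parity (x % n) xor false                 ≡⟨ xor-identityʳ (parity (x % n)) ⟩
  parity (x % n)                           ∎)
  where
  open ≡-Reasoning
  multiple-even : parity (x / n ℕ.* n) ≡ false
  multiple-even = trans (parity-* (x / n) n) (trans (cong (parity (x / n) ∧_) even-n) (∧-zeroʳ (parity (x / n))))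

%2≡parity : ∀ x → x % 2 ≡ (if parity x then 1 else 0)
%2≡parity x with x % 2 | m%n<n x 2 | parity-% x 2 refl
... | 0 | _               | p = cong (if_then 1 else 0) p
... | 1 | _               | p = cong (if_then 1 else 0) p
... | suc (suc _) | s≤s (s≤s ()) | _

≡mod2⇒parity≡ : ∀ {x y} → + x ≡ + y [mod 2 ] → parity x ≡ parity y
≡mod2⇒parity≡ {x} {y} x≡y = begin
  parity x        ≡⟨ parity-% x 2 refl ⟨
  parity (x % 2)  ≡⟨ cong parity (≡mod⇒≡ (m%n<n x 2) (m%n<n y 2) x%2≡y%2) ⟩
  parity (y % 2)  ≡⟨ parity-% y 2 refl ⟩
  parity y        ∎
  where
  open ≡-Reasoning
  x%2≡y%2 : + (x % 2) ≡ + (y % 2) [mod 2 ]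
  x%2≡y%2 = ≡mod-trans (≡mod-% x 2) (≡mod-trans x≡y (≡mod-sym (≡mod-% y 2)))

-- ℤₙ represented by Fin n

⟦_⟧ : ∀ {n} → Fin n → ℤ
⟦ i ⟧ = + toℕ i

⊕-≡mod : ∀ {n} (i : Fin (suc n)) k → ⟦ i ⊕ k ⟧ ≡ ⟦ i ⟧ + + k [mod suc n ]
⊕-≡mod {n} i k = begin
  ⟦ i ⊕ k ⟧                      ≡⟨ cong +_ (Fin.toℕ-fromℕ< (m%n<n (toℕ i ℕ.+ k) (suc n))) ⟩
  + ((toℕ i ℕ.+ k) % suc n)      ≈⟨ ≡mod-% (toℕ i ℕ.+ k) (suc n) ⟩
  + (toℕ i ℕ.+ k)                ≡⟨ ℤ.pos-+ (toℕ i) k ⟩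
  ⟦ i ⟧ + + k                    ∎
  where open ≡mod-Reasoning (suc n)

≡mod⇒Fin≡ : ∀ {n} {i j : Fin n} → ⟦ i ⟧ ≡ ⟦ j ⟧ [mod n ] → i ≡ j
≡mod⇒Fin≡ {i = i} {j} i≡j = Fin.toℕ-injective (≡mod⇒≡ (Fin.toℕ<n i) (Fin.toℕ<n j) i≡j)

⊕-suc : ∀ {n} (i : Fin (suc n)) k → (i ⊕ k) ⊕ 1 ≡ i ⊕ suc k
⊕-suc {n} i k = ≡mod⇒Fin≡ (begin
  ⟦ (i ⊕ k) ⊕ 1 ⟧       ≈⟨ ⊕-≡mod (i ⊕ k) 1 ⟩
  ⟦ i ⊕ k ⟧ + 1ℤ        ≈⟨ +-cong-≡mod (⊕-≡mod i k) (≡mod-refl {x = 1ℤ}) ⟩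
  ⟦ i ⟧ + + k + 1ℤ      ≡⟨ ℤ.+-assoc ⟦ i ⟧ (+ k) 1ℤ ⟩
  ⟦ i ⟧ + (+ k + 1ℤ)    ≡⟨ cong (_+_ ⟦ i ⟧) (ℤ.+-comm (+ k) 1ℤ) ⟩
  ⟦ i ⟧ + + suc k       ≈⟨ ⊕-≡mod i (suc k) ⟨
  ⟦ i ⊕ suc k ⟧         ∎)
  where open ≡mod-Reasoning (suc n)

⊕-fixed⇒≡0 : ∀ {n} (i : Fin (suc n)) {k} → i ⊕ k ≡ i → + k ≡ 0ℤ [mod suc n ]
⊕-fixed⇒≡0 {n} i {k} fixed = begin
  + k                  ≈⟨ ≡mod-difference (≡mod-refl {x = ⟦ i ⟧}) i+k≡i ⟩
  ⟦ i ⟧ - ⟦ i ⟧        ≡⟨ ℤ.+-inverseʳ ⟦ i ⟧ ⟩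
  0ℤ                   ∎
  where
  open ≡mod-Reasoning (suc n)
  i+k≡i : ⟦ i ⟧ + + k ≡ ⟦ i ⟧ [mod suc n ]
  i+k≡i = ≡mod-trans (≡mod-sym (⊕-≡mod i k)) (≡⇒≡mod (cong ⟦_⟧ fixed))

≡0⇒⊕-fixed : ∀ {n} (i : Fin (suc n)) {k} → + k ≡ 0ℤ [mod suc n ] → i ⊕ k ≡ i
≡0⇒⊕-fixed {n} i {k} k≡0 = ≡mod⇒Fin≡ (begin
  ⟦ i ⊕ k ⟧            ≈⟨ ⊕-≡mod i k ⟩
  ⟦ i ⟧ + + k          ≈⟨ +-cong-≡mod (≡mod-refl {x = ⟦ i ⟧}) k≡0 ⟩
  ⟦ i ⟧ + 0ℤ           ≡⟨ ℤ.+-identityʳ ⟦ i ⟧ ⟩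
  ⟦ i ⟧                ∎)
  where open ≡mod-Reasoning (suc n)

pres-≡ : ∀ {G H} (f : Iso G H) {x y x' y'} → fun f x ≡ x' → fun f y ≡ y' → E G x y → E H x' y'
pres-≡ f fx≡x' fy≡y' x~y = subst₂ (E _) fx≡x' fy≡y' (pres f _ _ x~y)

fun-injective : ∀ {G H} (f : Iso G H) {x y} → fun f x ≡ fun f y → x ≡ y
fun-injective f {x} {y} fx≡fy = trans (sym (inv-l f x)) (trans (cong (inv f) fx≡fy) (inv-l f y))

Iso-refl : ∀ {G} → Iso G G
Iso-refl = record
  { fun = λ x → x ; inv = λ x → x ; inv-l = λ _ → refl ; inv-r = λ _ → refl
  ; pres = λ _ _ e → e ; refl' = λ _ _ e → e }

edge-transitive-onto : ∀ {G} (P : V G → Set) → EdgeTransitive G →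
  ∀ {x y x' y'} → E G x y → E G x' y' → P x' → P y' →
  Σ (Aut G) λ g → P (fun g x) × P (fun g y)
edge-transitive-onto P edge-transitive {x} {y} {x'} {y'} x~y x'~y' Px' Py'
  with edge-transitive x y x' y' x~y x'~y'
... | g , inj₁ (gx≡x' , gy≡y') = g , subst P (sym gx≡x') Px' , subst P (sym gy≡y') Py'
... | g , inj₂ (gx≡y' , gy≡x') = g , subst P (sym gx≡y') Py' , subst P (sym gy≡x') Px'

-- Rose window graphs

ρ^-+ : ∀ {n} k l (p : RV n × Bool) → ρ^ (k ℕ.+ l) p ≡ ρ^ k (ρ^ l p)
ρ^-+ zero    l p = refl
ρ^-+ (suc k) l p = cong ρ (ρ^-+ k l p)

data Kind : Set where
  rim-kind hub-kind : Kind

vertex : ∀ {n} → Kind → Fin n → RV n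
vertex rim-kind = u
vertex hub-kind = v

-- Parametrised by n − 1 and a − 1, so that _⊕_ computes on Fin n and u_{a−1} can be named.
module RoseWindow (n-1 a-1 r : ℕ) where

  n a : ℕ
  n = suc n-1
  a = suc a-1

  Γ : Graph
  Γ = Rose n a r

  Γ×K₂ : Graph
  Γ×K₂ = DC Γ

  shift : ℕ → RV n → RV n
  shift k (u i) = u (i ⊕ k)
  shift k (v i) = v (i ⊕ k)

  index : RV n → Fin n
  index (u i) = i
  index (v i) = i

  shift-vertex : ∀ κ k i → shift k (vertex κ i) ≡ vertex κ (i ⊕ k)
  shift-vertex rim-kind k i = refl
  shift-vertex hub-kind k i = refl

  ρ^-shift : ∀ k x c → ρ^ k (x , c) ≡ (shift k x , c)
  ρ^-shift zero    (u i) c = cong (λ j → (u j , c)) (sym (≡0⇒⊕-fixed i ≡mod-refl))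
  ρ^-shift zero    (v i) c = cong (λ j → (v j , c)) (sym (≡0⇒⊕-fixed i ≡mod-refl))
  ρ^-shift (suc k) x     c = trans (cong ρ (ρ^-shift k x c)) (cong (_, c) (rotV-shift x))
    where
    rotV-shift : ∀ x → rotV (shift k x) ≡ shift (suc k) x
    rotV-shift (u i) = cong u (⊕-suc i k)
    rotV-shift (v i) = cong v (⊕-suc i k)

  ρ^-fixes : ∀ {k} → + k ≡ 0ℤ [mod n ] → ∀ p → ρ^ k p ≡ p
  ρ^-fixes {k} k≡0 (x , c) = trans (ρ^-shift k x c) (cong (_, c) (shift-fixes x))
    where
    shift-fixes : ∀ x → shift k x ≡ x
    shift-fixes (u i) = cong u (≡0⇒⊕-fixed i k≡0)
    shift-fixes (v i) = cong v (≡0⇒⊕-fixed i k≡0)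

  ρ^-fixed⇒≡0 : ∀ {k} p → ρ^ k p ≡ p → + k ≡ 0ℤ [mod n ]
  ρ^-fixed⇒≡0 {k} (x , c) fixed =
    ⊕-fixed⇒≡0 (index x) (trans (index-shift x) (cong (index ∘ proj₁) (trans (sym (ρ^-shift k x c)) fixed)))
    where
    index-shift : ∀ x → index x ⊕ k ≡ index (shift k x)
    index-shift (u i) = refl
    index-shift (v i) = refl

  ⊕-≡mod-minus : ∀ (i : Fin n) k → ⟦ i ⟧ ≡ ⟦ i ⊕ k ⟧ - + k [mod n ]
  ⊕-≡mod-minus i k = begin
    ⟦ i ⟧                  ≡⟨ add-sub ⟦ i ⟧ (+ k) ⟩
    ⟦ i ⟧ + + k - + k      ≈⟨ +-cong-≡mod (⊕-≡mod i k) (≡mod-refl {x = - + k}) ⟨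
    ⟦ i ⊕ k ⟧ - + k        ∎
    where
    open ≡mod-Reasoning n
    add-sub : ∀ x y → x ≡ x + y - y
    add-sub = solve-∀

  rim-neighbours : ∀ {j i} → E Γ (u j) (u i) → ⟦ i ⟧ ≡ ⟦ j ⟧ - 1ℤ ∨ ⟦ j ⟧ + 1ℤ [mod n ]
  rim-neighbours (inj₁ (rim j)) = inj₂ (⊕-≡mod j 1)
  rim-neighbours (inj₂ (rim i)) = inj₁ (⊕-≡mod-minus i 1)

  hub-neighbours : ∀ {j i} → E Γ (v j) (v i) → ⟦ i ⟧ ≡ ⟦ j ⟧ - + r ∨ ⟦ j ⟧ + + r [mod n ]
  hub-neighbours (inj₁ (hub j)) = inj₂ (⊕-≡mod j r)
  hub-neighbours (inj₂ (hub i)) = inj₁ (⊕-≡mod-minus i r)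

  spoke-neighbours : ∀ {j i} → E Γ (v j) (u i) → ⟦ i ⟧ ≡ ⟦ j ⟧ + 0ℤ ∨ ⟦ j ⟧ + + a [mod n ]
  spoke-neighbours (inj₂ (spoke j)) = inj₁ (≡⇒≡mod (sym (ℤ.+-identityʳ ⟦ j ⟧)))
  spoke-neighbours (inj₂ (spk2 j))  = inj₂ (⊕-≡mod j a)

  parity-⊕ : parity n ≡ false → ∀ (i : Fin n) k → parity (toℕ (i ⊕ k)) ≡ parity (toℕ i) xor parity k
  parity-⊕ even-n i k = begin
    parity (toℕ (i ⊕ k))            ≡⟨ cong parity (Fin.toℕ-fromℕ< (m%n<n (toℕ i ℕ.+ k) n)) ⟩
    parity ((toℕ i ℕ.+ k) % n)      ≡⟨ parity-% (toℕ i ℕ.+ k) n even-n ⟩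
    parity (toℕ i ℕ.+ k)            ≡⟨ parity-+ (toℕ i) k ⟩
    parity (toℕ i) xor parity k     ∎
    where open ≡-Reasoning

  bipartite : parity n ≡ false → parity a ≡ false → parity r ≡ true → Bipartite Γ
  bipartite even-n even-a odd-r = colour , properly-coloured
    where
    colour : RV n → Bool
    colour (u i) = parity (toℕ i)
    colour (v i) = not (parity (toℕ i))

    flips : ∀ {x y} → REdge n a r x y → colour y ≡ not (colour x)
    flips (rim i)   = trans (parity-⊕ even-n i 1) (xor-comm (parity (toℕ i)) true)
    flips (hub i)   = cong not (trans (parity-⊕ even-n i r)
                        (trans (cong (parity (toℕ i) xor_) odd-r) (xor-comm (parity (toℕ i)) true)))
    flips (spoke i) = refl
    flips (spk2 i)  = cong not (sym (trans (parity-⊕ even-n i a)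
                        (trans (cong (parity (toℕ i) xor_) even-a) (xor-identityʳ (parity (toℕ i))))))

    properly-coloured : ∀ x y → E Γ x y → colour x ≢ colour y
    properly-coloured x y (inj₁ x→y) cx≡cy = not-¬ refl (trans cx≡cy (flips x→y))
    properly-coloured x y (inj₂ y→x) cx≡cy = not-¬ refl (trans (sym cx≡cy) (flips y→x))

  same-hub-vertex : ∀ {i i' : Fin n} {b c c' : Bool} →
    ⟦ i ⟧ ≡ ⟦ i' ⟧ [mod n ] → b ≢ c → b ≢ c' → (v i ,′ c) ≡ (v i' , c')
  same-hub-vertex i≡i' b≢c b≢c' =
    cong₂ (λ j c → (v j , c)) (≡mod⇒Fin≡ i≡i') (not-injective (trans (sym (¬-not b≢c)) (¬-not b≢c')))

  hub-neighbour-pigeonhole : ∀ {j i₁ i₂ i₃ : Fin n} {b c₁ c₂ c₃ : Bool} →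
    E Γ×K₂ (v j , b) (v i₁ , c₁) → E Γ×K₂ (v j , b) (v i₂ , c₂) →
    E Γ×K₂ (v j , b) (v i₃ , c₃) →
    (v i₁ ,′ c₁) ≡ (v i₂ , c₂) ⊎ (v i₁ ,′ c₁) ≡ (v i₃ , c₃) ⊎ (v i₂ ,′ c₂) ≡ (v i₃ , c₃)
  hub-neighbour-pigeonhole (e₁ , b≢c₁) (e₂ , b≢c₂) (e₃ , b≢c₃)
    with pigeonhole-residues (hub-neighbours e₁) (hub-neighbours e₂) (hub-neighbours e₃)
  ... | inj₁ i₁≡i₂        = inj₁ (same-hub-vertex i₁≡i₂ b≢c₁ b≢c₂)
  ... | inj₂ (inj₁ i₁≡i₃) = inj₂ (inj₁ (same-hub-vertex i₁≡i₃ b≢c₁ b≢c₃))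
  ... | inj₂ (inj₂ i₂≡i₃) = inj₂ (inj₂ (same-hub-vertex i₂≡i₃ b≢c₂ b≢c₃))

  OfKind : Kind → V Γ×K₂ → Set
  OfKind κ p = Σ (Fin n) λ i → Σ Bool λ c → p ≡ (vertex κ i , c)

  rim≢hub : ∀ {i j : Fin n} {c d : Bool} → (u i ,′ c) ≢ (v j , d)
  rim≢hub ()

  kind-of : ∀ p → OfKind rim-kind p ⊎ OfKind hub-kind p
  kind-of (u i , c) = inj₁ (i , c , refl)
  kind-of (v i , c) = inj₂ (i , c , refl)

  uₐ uₐ₋₁ v₀ : V Γ×K₂
  uₐ   = (u (fzero ⊕ a) , false)
  uₐ₋₁ = (u (fzero ⊕ a-1) , true)
  v₀   = (v fzero , true)

  uₐ~uₐ₋₁ : E Γ×K₂ uₐ uₐ₋₁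
  uₐ~uₐ₋₁ = inj₂ (subst (REdge n a r (u (fzero ⊕ a-1)) ∘ u) (⊕-suc fzero a-1) (rim _)) , λ ()

  uₐ~ρ²uₐ₋₁ : E Γ×K₂ uₐ (ρ^ 2 uₐ₋₁)
  uₐ~ρ²uₐ₋₁ =
    inj₁ (subst (λ j → REdge n a r (u j) (proj₁ (ρ^ 2 uₐ₋₁))) (⊕-suc fzero a-1) (rim _)) , λ ()

  uₐ~v₀ : E Γ×K₂ uₐ v₀
  uₐ~v₀ = inj₁ (spk2 fzero) , λ ()

  uₐ~ρᵃv₀ : E Γ×K₂ uₐ (ρ^ a v₀)
  uₐ~ρᵃv₀ = subst (E Γ×K₂ uₐ) (sym (ρ^-shift a (v fzero) true)) (inj₁ (spoke _) , λ ())

  module Normalising (g : Aut Γ×K₂) (l : ℕ) (g-ρ : ∀ p → fun g (ρ (inv g p)) ≡ ρ^ l p) where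

    g-ρ^ : ∀ k p → fun g (ρ^ k p) ≡ ρ^ (k ℕ.* l) (fun g p)
    g-ρ^ zero    p = refl
    g-ρ^ (suc k) p = begin
      fun g (ρ (ρ^ k p))                  ≡⟨ cong (fun g ∘ ρ) (inv-l g (ρ^ k p)) ⟨
      fun g (ρ (inv g (fun g (ρ^ k p))))  ≡⟨ g-ρ (fun g (ρ^ k p)) ⟩
      ρ^ l (fun g (ρ^ k p))               ≡⟨ cong (ρ^ l) (g-ρ^ k p) ⟩
      ρ^ l (ρ^ (k ℕ.* l) (fun g p))       ≡⟨ ρ^-+ l (k ℕ.* l) (fun g p) ⟨
      ρ^ (suc k ℕ.* l) (fun g p)          ∎
      where open ≡-Reasoning

    g-ρ^-vertex : ∀ κ {y i c} k → fun g y ≡ (vertex κ i , c) →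
                  fun g (ρ^ k y) ≡ (vertex κ (i ⊕ (k ℕ.* l)) , c)
    g-ρ^-vertex κ {y} {i} {c} k gy = begin
      fun g (ρ^ k y)                        ≡⟨ g-ρ^ k y ⟩
      ρ^ (k ℕ.* l) (fun g y)                ≡⟨ cong (ρ^ (k ℕ.* l)) gy ⟩
      ρ^ (k ℕ.* l) (vertex κ i , c)         ≡⟨ ρ^-shift (k ℕ.* l) (vertex κ i) c ⟩
      (shift (k ℕ.* l) (vertex κ i) , c)    ≡⟨ cong (_, c) (shift-vertex κ (k ℕ.* l) i) ⟩
      (vertex κ (i ⊕ (k ℕ.* l)) , c)          ∎
      where open ≡-Reasoning

    scale-≢0 : ∀ {k} → ¬ + k ≡ 0ℤ [mod n ] → ¬ + (k ℕ.* l) ≡ 0ℤ [mod n ]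
    scale-≢0 {k} k≢0 kl≡0 =
      k≢0 (ρ^-fixed⇒≡0 p (fun-injective g (trans (g-ρ^ k p) (ρ^-fixes kl≡0 (fun g p)))))
      where
      p : V Γ×K₂
      p = (u fzero , false)

    rotated-neighbours : ∀ {κ κ' α β} →
      (∀ {j i} → E Γ (vertex κ j) (vertex κ' i) → ⟦ i ⟧ ≡ ⟦ j ⟧ + α ∨ ⟦ j ⟧ + β [mod n ]) →
      ∀ {w y k j i b c} → E Γ×K₂ w y → E Γ×K₂ w (ρ^ k y) → ¬ + k ≡ 0ℤ [mod n ] →
      fun g w ≡ (vertex κ j , b) → fun g y ≡ (vertex κ' i , c) →
      + (k ℕ.* l) ≡± β - α [mod n ]
    rotated-neighbours {κ} {κ'} {α} {β} neighbours {w} {y} {k} {j} {i} {b} w~y w~ρy k≢0 gw gy =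
      shift-between-residues {c = ⟦ j ⟧} {α} {β}
        (neighbours (image-edge w~y gy))
        (∨-resp-≡mod (⊕-≡mod i (k ℕ.* l)) (neighbours (image-edge w~ρy (g-ρ^-vertex κ' k gy))))
        (scale-≢0 k≢0)
      where
      image-edge : ∀ {y' i' c'} → E Γ×K₂ w y' → fun g y' ≡ (vertex κ' i' , c') →
                   E Γ (vertex κ j) (vertex κ' i')
      image-edge w~y' gy' = proj₁ (pres-≡ g gw gy' w~y')

    v₀-not-to-hub : ¬ + 2 ≡ 0ℤ [mod n ] →
      OfKind hub-kind (fun g uₐ) → OfKind hub-kind (fun g uₐ₋₁) → ¬ OfKind hub-kind (fun g v₀)
    v₀-not-to-hub 2≢0 (j , b , g-uₐ) (i , c , g-uₐ₋₁) (i' , c' , g-v₀) =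
      [ ρ²-fixes-uₐ₋₁ , [ rim≢hub ∘ same-preimage g-uₐ₋₁ , rim≢hub ∘ same-preimage g-ρ²uₐ₋₁ ]′ ]′
        (hub-neighbour-pigeonhole (pres-≡ g g-uₐ g-uₐ₋₁ uₐ~uₐ₋₁)
                                  (pres-≡ g g-uₐ g-ρ²uₐ₋₁ uₐ~ρ²uₐ₋₁)
                                  (pres-≡ g g-uₐ g-v₀ uₐ~v₀))
      where
      g-ρ²uₐ₋₁ : fun g (ρ^ 2 uₐ₋₁) ≡ (v (i ⊕ (2 ℕ.* l)) , c)
      g-ρ²uₐ₋₁ = g-ρ^-vertex hub-kind 2 g-uₐ₋₁

      same-preimage : ∀ {y i₁ c₁} → fun g y ≡ (v i₁ , c₁) → (v i₁ ,′ c₁) ≡ (v i' , c') → y ≡ v₀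
      same-preimage gy same = fun-injective g (trans gy (trans same (sym g-v₀)))

      ρ²-fixes-uₐ₋₁ : (v i ,′ c) ≡ (v (i ⊕ (2 ℕ.* l)) , c) → ⊥
      ρ²-fixes-uₐ₋₁ same =
        2≢0 (ρ^-fixed⇒≡0 uₐ₋₁ (fun-injective g (trans g-ρ²uₐ₋₁ (sym (trans g-uₐ₋₁ same)))))

    hub-image-constraints : ¬ + 2 ≡ 0ℤ [mod n ] → ¬ + a ≡ 0ℤ [mod n ] →
      OfKind hub-kind (fun g uₐ) → OfKind hub-kind (fun g uₐ₋₁) →
      + 2 * + l ≡± + 2 * + r [mod n ] × + a * + l ≡± + a [mod n ]
    hub-image-constraints 2≢0 a≢0 hub-uₐ@(j , b , g-uₐ) hub-uₐ₋₁@(i , c , g-uₐ₋₁) =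
      ≡±-resp (ℤ.pos-* 2 l) (double (+ r))
        (rotated-neighbours {hub-kind} {hub-kind} {α = - + r} {+ r}
           hub-neighbours uₐ~uₐ₋₁ uₐ~ρ²uₐ₋₁ 2≢0 g-uₐ g-uₐ₋₁) ,
      ≡±-resp (ℤ.pos-* a l) (ℤ.+-identityʳ (+ a)) (spoke-step (kind-of (fun g v₀)))
      where
      double : ∀ x → x - - x ≡ + 2 * x
      double = solve-∀

      spoke-step : OfKind rim-kind (fun g v₀) ⊎ OfKind hub-kind (fun g v₀) →
                   + (a ℕ.* l) ≡± + a - 0ℤ [mod n ]
      spoke-step (inj₁ (i' , c' , g-v₀)) =
        rotated-neighbours {hub-kind} {rim-kind} {0ℤ} {+ a}
          spoke-neighbours uₐ~v₀ uₐ~ρᵃv₀ a≢0 g-uₐ g-v₀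
      spoke-step (inj₂ hub-v₀) = ⊥-elim (v₀-not-to-hub 2≢0 hub-uₐ hub-uₐ₋₁ hub-v₀)

    rim-image-constraint : ¬ + a ≡ 0ℤ [mod n ] →
      OfKind rim-kind (fun g uₐ) → OfKind rim-kind (fun g v₀) → + a * + l ≡± + 2 [mod n ]
    rim-image-constraint a≢0 (j , b , g-uₐ) (i , c , g-v₀) =
      ≡±-resp (ℤ.pos-* a l) refl
        (rotated-neighbours {rim-kind} {rim-kind} {α = - 1ℤ} {1ℤ}
           rim-neighbours uₐ~v₀ uₐ~ρᵃv₀ a≢0 g-uₐ g-v₀)

  hub-constraints : EdgeTransitive Γ×K₂ → CNormal n a r →
    ¬ + 2 ≡ 0ℤ [mod n ] → ¬ + a ≡ 0ℤ [mod n ] →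
    Σ ℕ λ l → + 2 * + l ≡± + 2 * + r [mod n ] × + a * + l ≡± + a [mod n ]
  hub-constraints edge-transitive normal 2≢0 a≢0 =
    let g , hub-uₐ , hub-uₐ₋₁ = edge-transitive-onto (OfKind hub-kind) edge-transitive
          uₐ~uₐ₋₁ (inj₁ (hub fzero) , λ ()) (fzero , false , refl) (fzero ⊕ r , true , refl)
        l , g-ρ = normal g 1
    in  l , Normalising.hub-image-constraints g l g-ρ 2≢0 a≢0 hub-uₐ hub-uₐ₋₁

  rim-constraints : EdgeTransitive Γ×K₂ → CNormal n a r → ¬ + a ≡ 0ℤ [mod n ] →
    Σ ℕ λ l → + a * + l ≡± + 2 [mod n ] ×
              (∀ {k} → ¬ + k ≡ 0ℤ [mod n ] → ¬ + (k ℕ.* l) ≡ 0ℤ [mod n ])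
  rim-constraints edge-transitive normal a≢0 =
    let g , rim-uₐ , rim-v₀ = edge-transitive-onto (OfKind rim-kind) edge-transitive
          uₐ~v₀ (inj₁ (rim fzero) , λ ()) (fzero , false , refl) (fzero ⊕ 1 , true , refl)
        l , g-ρ = normal g 1
        open Normalising g l g-ρ
    in  l , rim-image-constraint a≢0 rim-uₐ rim-v₀ , scale-≢0

-- Arithmetic of the exponents

eliminate-exponents : ∀ {m L₁ L₂ A R} →
  + 2 * L₁ ≡± + 2 * R [mod 2 ℕ.* m ] → A * L₁ ≡± A [mod 2 ℕ.* m ] →
  A * L₂ ≡± + 2 [mod 2 ℕ.* m ] → R ≡± 1ℤ [mod m ]
eliminate-exponents {m} {L₁} {L₂} {A} {R} (ε₁ , u₁ , h₁) (ε₂ , u₂ , h₂) (ε₃ , u₃ , h₃) =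
  ε₁ * ε₂ , IsUnit-* u₁ u₂ , *-cancelˡ-≡mod 2 (begin
    + 2 * R              ≈⟨ unit-swap u₁ h₁ ⟩
    ε₁ * (+ 2 * L₁)      ≈⟨ *-congˡ-≡mod ε₁ twice-L₁ ⟩
    ε₁ * (ε₂ * + 2)      ≡⟨ solve (ε₁ ∷ ε₂ ∷ []) ⟩
    + 2 * (ε₁ * ε₂ * 1ℤ) ∎)
  where
  open ≡mod-Reasoning (2 ℕ.* m)
  twice-L₁ : + 2 * L₁ ≡ ε₂ * + 2 [mod 2 ℕ.* m ]
  twice-L₁ = begin
    + 2 * L₁                  ≈⟨ *-congʳ-≡mod L₁ (unit-swap u₃ h₃) ⟩
    ε₃ * (A * L₂) * L₁        ≡⟨ solve (ε₃ ∷ A ∷ L₂ ∷ L₁ ∷ []) ⟩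
    ε₃ * L₂ * (A * L₁)        ≈⟨ *-congˡ-≡mod (ε₃ * L₂) h₂ ⟩
    ε₃ * L₂ * (ε₂ * A)        ≡⟨ solve (ε₃ ∷ L₂ ∷ ε₂ ∷ A ∷ []) ⟩
    ε₂ * ε₃ * (A * L₂)        ≈⟨ *-congˡ-≡mod (ε₂ * ε₃) h₃ ⟩
    ε₂ * ε₃ * (ε₃ * + 2)      ≡⟨ solve (ε₂ ∷ ε₃ ∷ []) ⟩
    ε₂ * (ε₃ * ε₃) * + 2      ≡⟨ cong (λ t → ε₂ * t * + 2) (IsUnit-square u₃) ⟩
    ε₂ * 1ℤ * + 2             ≡⟨ solve (ε₂ ∷ []) ⟩
    ε₂ * + 2                  ∎

modulus≢±1 : ∀ {m} → 2 ℕ.≤ m → ¬ + m ≡± 1ℤ [mod m ]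
modulus≢±1 {m} 2≤m (_ , one , m≡1) =
  ≢0-below (s≤s z≤n) 2≤m (≡mod-trans (≡mod-sym m≡1) (modulus≡0 m))
modulus≢±1 {m} 2≤m (_ , minus-one , m≡-1) =
  ≢0-below (s≤s z≤n) 2≤m (-‿cong-≡mod (≡mod-trans (≡mod-sym m≡-1) (modulus≡0 m)))

<⇒≡±1⇒1∨m-1 : ∀ {m r} → 2 ℕ.≤ m → r ℕ.< m → + r ≡± 1ℤ [mod m ] → r ≡ 1 ⊎ suc r ≡ m
<⇒≡±1⇒1∨m-1 2≤m r<m (_ , one , r≡1) = inj₁ (≡mod⇒≡ r<m 2≤m r≡1)
<⇒≡±1⇒1∨m-1 2≤m r<m (_ , minus-one , r≡-1) with ℕ.m≤n⇒m<n∨m≡n r<m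
... | inj₁ 1+r<m = contradiction
  (≡mod⇒≡ 1+r<m (ℕ.<-trans (s≤s z≤n) 2≤m) (+-cong-≡mod (≡mod-refl {x = 1ℤ}) r≡-1)) λ ()
... | inj₂ 1+r≡m = inj₂ 1+r≡m

≤⇒≡±1⇒1∨m-1 : ∀ {m r} → 2 ℕ.≤ m → r ℕ.≤ m → + r ≡± 1ℤ [mod m ] → r ≡ 1 ⊎ suc r ≡ m
≤⇒≡±1⇒1∨m-1 2≤m r≤m r≡±1 with ℕ.m≤n⇒m<n∨m≡n r≤m
... | inj₁ r<m  = <⇒≡±1⇒1∨m-1 2≤m r<m r≡±1
... | inj₂ refl = contradiction r≡±1 (modulus≢±1 2≤m)

≡±2⇒even : ∀ {m a l} → + a * + l ≡± + 2 [mod 2 ℕ.* m ] → parity l ≡ true → parity a ≡ false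
≡±2⇒even {m} {a} {l} (ε , _ , al≡2ε) odd-l = begin
  parity a              ≡⟨ ∧-identityʳ (parity a) ⟨
  parity a ∧ true       ≡⟨ cong (parity a ∧_) odd-l ⟨
  parity a ∧ parity l   ≡⟨ parity-* a l ⟨
  parity (a ℕ.* l)      ≡⟨ ≡mod2⇒parity≡ al≡0 ⟩
  parity 0              ∎
  where
  open ≡-Reasoning
  al≡0 : + (a ℕ.* l) ≡ + 0 [mod 2 ]
  al≡0 = ≡mod-trans (≡⇒≡mod (ℤ.pos-* a l))
           (≡mod-trans (≡mod-∣ (ℕ.m∣m*n m) al≡2ε) (≡mod (divides ε (ℤ.+-identityʳ (ε * + 2)))))

odd-exponent : ∀ {m l} → 0 ℕ.< m →
  (∀ {k} → ¬ + k ≡ 0ℤ [mod 2 ℕ.* m ] → ¬ + (k ℕ.* l) ≡ 0ℤ [mod 2 ℕ.* m ]) → parity l ≡ true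
odd-exponent {m} {l} 0<m scale-≢0 with parity l in parity-l
... | true  = refl
... | false = contradiction ml≡0 (scale-≢0 (≢0-below 0<m m<2m))
  where
  m<2m : m ℕ.< 2 ℕ.* m
  m<2m = subst (m ℕ.<_) (cong (m ℕ.+_) (sym (ℕ.+-identityʳ m))) (ℕ.m<m+n m 0<m)
  ml≡0 : + (m ℕ.* l) ≡ 0ℤ [mod 2 ℕ.* m ]
  ml≡0 with ℕ.m%n≡0⇒n∣m l 2 (trans (%2≡parity l) (cong (if_then 1 else 0) parity-l))
  ... | ℕ.divides q refl = subst (λ t → + t ≡ 0ℤ [mod 2 ℕ.* m ]) (rearrange q m) (multiple≡0 q (2 ℕ.* m))
    where
    rearrange : ∀ x y → x ℕ.* (2 ℕ.* y) ≡ y ℕ.* (x ℕ.* 2)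
    rearrange = ℕ-Solver.solve-∀

W4-member : ∀ {m a r} → 2 ℕ.≤ m → 1 ℕ.≤ a → a ℕ.< 2 ℕ.* m →
  parity a ≡ false → parity r ≡ false → r ≡ 1 ⊎ suc r ≡ m →
  (m % 2 ≡ 1) × InW4 (Rose (2 ℕ.* m) a r)
W4-member _ _ _ _ even-r (inj₁ refl) = contradiction even-r λ ()
W4-member {m} {a} {r} 2≤m (s≤s _) a<2m even-a even-r (inj₂ 1+r≡m) =
  trans (%2≡parity m) (cong (if_then 1 else 0) odd-m) ,
  m , a , 2≤m , a<2m , (λ ()) , a≢m , subst (Iso Γ ∘ Rose (2 ℕ.* m) a) r≡m-1 Iso-refl
  where
  Γ : Graph
  Γ = Rose (2 ℕ.* m) a r
  odd-m : parity m ≡ true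
  odd-m = subst (λ t → parity t ≡ true) 1+r≡m (cong not even-r)
  a≢m : a ≢ m
  a≢m a≡m = contradiction (trans (sym even-a) (trans (cong parity a≡m) odd-m)) λ ()
  r≡m-1 : r ≡ m ℕ.∸ 1
  r≡m-1 = cong (ℕ._∸ 1) 1+r≡m

lemma6p2 : (m a r : ℕ) → 2 ℕ.≤ m → 1 ℕ.≤ a → a ℕ.≤ m → 1 ℕ.≤ r → r ℕ.≤ m →
    NontriviallyUnstable (Rose (2 ℕ.* m) a r) →
    EdgeTransitive (DC (Rose (2 ℕ.* m) a r)) →
    CNormal (2 ℕ.* m) a r →
    (m % 2 ≡ 1) × InW4 (Rose (2 ℕ.* m) a r)
lemma6p2 m a r 2≤m@(s≤s (s≤s _)) 1≤a@(s≤s _) a≤m _ r≤m (_ , _ , not-bipartite , _)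
         edge-transitive normal =
  let l₁ , 2l₁≡±2r , al₁≡±a = hub-constraints edge-transitive normal (≢0-below (s≤s z≤n) 2<n) a≢0
      l₂ , al₂≡±2 , l₂-invertible = rim-constraints edge-transitive normal a≢0
      even-a = ≡±2⇒even {m} {a} {l₂} al₂≡±2 (odd-exponent {m} {l₂} (s≤s z≤n) l₂-invertible)
      even-r = ¬-not λ odd-r → not-bipartite (bipartite (parity-* 2 m) even-a odd-r)
  in  W4-member 2≤m 1≤a a<n even-a even-r
        (≤⇒≡±1⇒1∨m-1 2≤m r≤m (eliminate-exponents {m} 2l₁≡±2r al₁≡±a al₂≡±2))
  where
  -- Once m and a are successors, suc (pred (2 * m)) and suc (pred a) reduce to 2 * m and a.
  open RoseWindow (ℕ.pred (2 ℕ.* m)) (ℕ.pred a) r hiding (a)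
  m<n : m ℕ.< n
  m<n = ℕ.m<m+n m (ℕ.<-≤-trans (s≤s z≤n) (ℕ.m≤m+n m 0))
  2<n : 2 ℕ.< n
  2<n = ℕ.≤-<-trans 2≤m m<n
  a<n : a ℕ.< n
  a<n = ℕ.≤-<-trans a≤m m<n
  a≢0 : ¬ + a ≡ 0ℤ [mod n ]
  a≢0 = ≢0-below 1≤a a<n
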